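{- Let $\delta$ be an algebraic integer of degree $2$, let $a,b,g\in\mathbb{Z}$ and let $p$ be a prime number such that $p\mid g$, $g\mid b$ and $p\nmid a$. Let $k$ be a positive integer and write $(a+b\delta)^k=a_k+b_k\delta$ with $a_k,b_k\in\mathbb{Z}$. Let $e$ be the multiplicative order of $a$ modulo $p$ if $p$ is odd, and the multiplicative order of $a$ modulo $4$ if $p=2$. If $p=2$ and $v_2(b)=1$, assume additionally that $k$ is odd. Then the assertions \[ v_p(a_k-1)>v_p(b_k)-v_p(g) \] and \[ \bigl(v_p(a^e-1)-v_p(e)>v_p(b)-v_p(g)\ \text{ and }\ e\mid k\bigr)\quad\text{or}\quad (p,v_2(k),v_2(b/g))=(2,0,0) \] are equivalent.
   Context: $v_p$ denotes the $p$-adic valuation. Since $\delta$ is an algebraic integer of degree $2$, $\mathbb{Z}[\delta]=\mathbb{Z}+\mathbb{Z}\delta$, so integers $a_k,b_k$ as in the statement exist and are unique. -}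

module Defs where

open import Data.Nat as ℕ using (ℕ; zero; suc)
open import Data.Nat.Divisibility using (_∣?_)
open import Data.Nat.DivMod using (_/_)
open import Data.Integer as ℤ using (ℤ; +_; ∣_∣)
open import Data.Rational as ℚ using (ℚ)
open import Data.Maybe using (Maybe; just; nothing)
open import Data.Product using (_×_; _,_; proj₁; proj₂)
open import Relation.Nullary using (¬_; yes; no)
open import Relation.Binary.PropositionalEquality using (_≡_; _≢_)

-- A quadratic algebraic integer δ is given by its monic minimal polynomial
-- X² - t X + n (t n : ℤ), i.e. δ² = t δ - n.  "Degree exactly 2" means this
-- polynomial has no rational root (δ ∉ ℚ).
record QuadInt : Set where
  constructor quad
  field
    tr nm : ℤ

DegreeTwo : QuadInt → Set
DegreeTwo (quad t n) =
  (r : ℚ) → (r ℚ.* r ℚ.- (t ℚ./ 1) ℚ.* r ℚ.+ (n ℚ./ 1)) ≢ ℚ.0ℚ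

-- Elements x + y δ of ℤ[δ] = ℤ + ℤ δ, as pairs (x , y).
ZDelta : Set
ZDelta = ℤ × ℤ

-- (x + yδ)(u + wδ) = xu + (xw + yu)δ + yw(tδ - n)
mulδ : QuadInt → ZDelta → ZDelta → ZDelta
mulδ (quad t n) (x , y) (u , w) =
  (x ℤ.* u ℤ.- y ℤ.* w ℤ.* n , x ℤ.* w ℤ.+ y ℤ.* u ℤ.+ y ℤ.* w ℤ.* t)

powδ : QuadInt → ZDelta → ℕ → ZDelta
powδ δ z zero = (ℤ.1ℤ , ℤ.0ℤ)
powδ δ z (suc k) = mulδ δ z (powδ δ z k)

-- p-adic valuation of a natural number, with fuel (fuel ≥ m suffices for m ≠ 0, p ≥ 2)
vℕ-go : ℕ → ℕ → ℕ → ℕ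
vℕ-go zero p m = zero
vℕ-go (suc f) zero m = zero
vℕ-go (suc f) (suc q) m with suc q ∣? m
... | yes _ = suc (vℕ-go f (suc q) (m / suc q))
... | no _ = zero

-- p-adic valuation on ℤ; nothing stands for +∞ (valuation of 0)
vp : ℕ → ℤ → Maybe ℕ
vp p z with ∣ z ∣
... | zero = nothing
... | suc m = just (vℕ-go (suc m) p (suc m))

-- GtSub x y c  ⇔  x > y - c  in ℤ ∪ {+∞}  (c finite), with ∞ > finite, ¬ (∞ > ∞)
GtSub : Maybe ℕ → Maybe ℕ → ℕ → Set
GtSub nothing nothing c = ⊥' where open import Data.Empty renaming (⊥ to ⊥')
GtSub nothing (just y) c = ⊤' where open import Data.Unit renaming (⊤ to ⊤')
GtSub (just x) nothing c = ⊥' where open import Data.Empty renaming (⊥ to ⊥')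
GtSub (just x) (just y) c = (+ x) ℤ.> (+ y) ℤ.- (+ c)

-- x - d > y - c  in ℤ ∪ {+∞}, d and c finite
GtSub₂ : Maybe ℕ → ℕ → Maybe ℕ → ℕ → Set
GtSub₂ nothing d nothing c = ⊥' where open import Data.Empty renaming (⊥ to ⊥')
GtSub₂ nothing d (just y) c = ⊤' where open import Data.Unit renaming (⊤ to ⊤')
GtSub₂ (just x) d nothing c = ⊥' where open import Data.Empty renaming (⊥ to ⊥')
GtSub₂ (just x) d (just y) c = (+ x) ℤ.- (+ d) ℤ.> (+ y) ℤ.- (+ c)

IsMultOrder : ℕ → ℤ → ℕ → Set
IsMultOrder m a e =
  (1 ℕ.≤ e) × ((+ m) ID.∣ (a ℤ.^ e ℤ.- ℤ.1ℤ)) ×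
  ((e' : ℕ) → 1 ℕ.≤ e' → e' ℕ.< e → ¬ ((+ m) ID.∣ (a ℤ.^ e' ℤ.- ℤ.1ℤ)))
  where import Data.Integer.Divisibility as ID

orderModulus : ℕ → ℕ
orderModulus p with p ℕ.≟ 2
... | yes _ = 4
... | no _ = p

-- finite valuation (used only on nonzero arguments; value 0 at 0 is irrelevant there)
vpNZ : ℕ → ℤ → ℕ
vpNZ p z with vp p z
... | nothing = 0
... | just m = m

{-# OPTIONS --safe #-}
module Submission where

-- Write β = v(b) = v(q) + v(g) ≥ 1 and κ = v(k).  For p ∤ m, expanding (a + bδ)^m to first
-- order in b gives the δ-coefficient m a^(m-1) b + O(b²), of valuation exactly β, and a
-- scalar part ≡ a^m (mod p^β).  Raising such an element to the p-th power raises both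
-- exponents by one, because the second-order term C(p,2) (...) b² is divisible by p^(β+2)
-- unless p = 2 and β = 1, the case excluded by the parity hypothesis.  Hence v(b_k) = β + κ
-- and a_k ≡ a^k (mod p^(β+κ)), so the left-hand side says exactly p^(v(q)+κ+1) ∣ a^k - 1.
-- In ℤ[ε] with ε² = ε one has (1 + (A - 1)ε)^l = 1 + (A^l - 1)ε, so the same statement is
-- the lifting-the-exponent lemma v(A^l - 1) = v(A - 1) + v(l).  With A = a^e it turns the
-- divisibility into the inequality on the right when e ∣ k; when e ∤ k both sides amount
-- to p = 2 and v(q) = 0.

open import Defs
open import Data.Nat as ℕ using (ℕ; zero; suc; _≤_; _<_; z≤n; s≤s; NonZero; _%_)
import Data.Nat.Properties as ℕ
import Data.Nat.Divisibility as ℕ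
import Data.Nat.DivMod as ℕ
open import Data.Nat.Combinatorics using (_C_; nC1≡n; nCk+nC[k+1]≡[n+1]C[k+1])
open import Data.Integer as ℤ using (ℤ; +_; _+_; _*_; _-_; -_; _^_; 0ℤ; 1ℤ)
import Data.Integer.Properties as ℤ
open import Data.Integer.DivMod using (_%ℕ_; _/ℕ_; a≡a%ℕn+[a/ℕn]*n; n%ℕd<d)
open import Data.Integer.Divisibility using (_∣_)
import Data.Integer.Divisibility.Signed as Signed
open import Data.Integer.Tactic.RingSolver using (solve-∀)
open import Data.Nat.Tactic.RingSolver using () renaming (solve-∀ to ℕ-solve-∀)
open import Data.Maybe using (just; nothing)
open import Data.Maybe.Properties using (just-injective)
open import Data.Nat.Primality using (Prime; euclidsLemma; prime⇒nonZero; prime⇒nonTrivial)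
open import Data.Sum using (_⊎_; inj₁; inj₂)
open import Data.Unit using (tt)
open import Data.Product using (_×_; _,_; proj₁; proj₂; ∃-syntax; ∃₂)
open import Data.Empty using (⊥-elim)
open import Function using (_∘_)
open import Function.Bundles using (_⇔_; mk⇔; module Equivalence)
import Function.Properties.Equivalence as ⇔
open import Relation.Nullary using (¬_; yes; no; contradiction)
open import Relation.Binary.PropositionalEquality

-- The ring ℤ[δ] and binomial expansions

mulδ-assoc : ∀ δ x y z → mulδ δ x (mulδ δ y z) ≡ mulδ δ (mulδ δ x y) z
mulδ-assoc (quad t n) (x₁ , x₂) (y₁ , y₂) (z₁ , z₂) =
  cong₂ _,_ (scalar x₁ x₂ y₁ y₂ z₁ z₂ t n) (δ-coefficient x₁ x₂ y₁ y₂ z₁ z₂ t n)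
  where
  scalar : ∀ x₁ x₂ y₁ y₂ z₁ z₂ t n →
    x₁ * (y₁ * z₁ - y₂ * z₂ * n) - x₂ * (y₁ * z₂ + y₂ * z₁ + y₂ * z₂ * t) * n
    ≡ (x₁ * y₁ - x₂ * y₂ * n) * z₁ - (x₁ * y₂ + x₂ * y₁ + x₂ * y₂ * t) * z₂ * n
  scalar = solve-∀
  δ-coefficient : ∀ x₁ x₂ y₁ y₂ z₁ z₂ t n →
    x₁ * (y₁ * z₂ + y₂ * z₁ + y₂ * z₂ * t) + x₂ * (y₁ * z₁ - y₂ * z₂ * n)
      + x₂ * (y₁ * z₂ + y₂ * z₁ + y₂ * z₂ * t) * t
    ≡ (x₁ * y₁ - x₂ * y₂ * n) * z₂ + (x₁ * y₂ + x₂ * y₁ + x₂ * y₂ * t) * z₁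
      + (x₁ * y₂ + x₂ * y₁ + x₂ * y₂ * t) * z₂ * t
  δ-coefficient = solve-∀

mulδ-identityˡ : ∀ δ x → mulδ δ (1ℤ , 0ℤ) x ≡ x
mulδ-identityˡ (quad t n) (u , w) = cong₂ _,_ (scalar u w n) (δ-coefficient u w t)
  where
  scalar : ∀ u w n → 1ℤ * u - 0ℤ * w * n ≡ u
  scalar = solve-∀
  δ-coefficient : ∀ u w t → 1ℤ * w + 0ℤ * u + 0ℤ * w * t ≡ w
  δ-coefficient = solve-∀

powδ-+ : ∀ δ x i j → powδ δ x (i ℕ.+ j) ≡ mulδ δ (powδ δ x i) (powδ δ x j)
powδ-+ δ x zero    j = sym (mulδ-identityˡ δ (powδ δ x j))
powδ-+ δ x (suc i) j = trans (cong (mulδ δ x) (powδ-+ δ x i j)) (mulδ-assoc δ x _ _)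

powδ-* : ∀ δ x i j → powδ δ x (i ℕ.* j) ≡ powδ δ (powδ δ x i) j
powδ-* δ x i zero    = cong (powδ δ x) (ℕ.*-zeroʳ i)
powδ-* δ x i (suc j) = begin
  powδ δ x (i ℕ.* suc j)                      ≡⟨ cong (powδ δ x) (ℕ.*-suc i j) ⟩
  powδ δ x (i ℕ.+ i ℕ.* j)                    ≡⟨ powδ-+ δ x i (i ℕ.* j) ⟩
  mulδ δ (powδ δ x i) (powδ δ x (i ℕ.* j))    ≡⟨ cong (mulδ δ (powδ δ x i)) (powδ-* δ x i j) ⟩
  mulδ δ (powδ δ x i) (powδ δ (powδ δ x i) j) ∎
  where open ≡-Reasoning

powδ-scalar : ∀ δ a k → powδ δ (a , 0ℤ) k ≡ (a ^ k , 0ℤ)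
powδ-scalar δ          a zero    = refl
powδ-scalar (quad t n) a (suc k) =
  trans (cong (mulδ (quad t n) (a , 0ℤ)) (powδ-scalar (quad t n) a k))
        (cong₂ _,_ (scalar a (a ^ k) n) (δ-coefficient a (a ^ k) t))
  where
  scalar : ∀ a A n → a * A - 0ℤ * 0ℤ * n ≡ a * A
  scalar = solve-∀
  δ-coefficient : ∀ a A t → a * 0ℤ + 0ℤ * A + 0ℤ * 0ℤ * t ≡ 0ℤ
  δ-coefficient = solve-∀

powδ-idempotent : ∀ w h l → powδ (quad (+ 1) 0ℤ) (w , h) l ≡ (w ^ l , (w + h) ^ l - w ^ l)
powδ-idempotent w h zero    = refl
powδ-idempotent w h (suc l) =
  trans (cong (mulδ (quad (+ 1) 0ℤ) (w , h)) (powδ-idempotent w h l))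
        (cong₂ _,_ (scalar w h (w ^ l) ((w + h) ^ l)) (δ-coefficient w h (w ^ l) ((w + h) ^ l)))
  where
  scalar : ∀ w h W X → w * W - h * (X - W) * 0ℤ ≡ w * W
  scalar = solve-∀
  δ-coefficient : ∀ w h W X → w * (X - W) + h * W + h * (X - W) * + 1 ≡ (w + h) * X - w * W
  δ-coefficient = solve-∀

powδ-first-order : ∀ t n c d {m} → 1 ≤ m → ∃₂ λ U V →
  powδ (quad t n) (c , d) m ≡ (c ^ m + d * d * U , + m * c ^ (m ℕ.∸ 1) * d + d * d * V)
powδ-first-order t n c d {zero}  ()
powδ-first-order t n c d {suc zero} _ =
  0ℤ , 0ℤ , cong₂ _,_ (scalar c d n) (δ-coefficient c d t)
  where
  scalar : ∀ c d n → c * 1ℤ - d * 0ℤ * n ≡ c * 1ℤ + d * d * 0ℤ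
  scalar = solve-∀
  δ-coefficient : ∀ c d t → c * 0ℤ + d * 1ℤ + d * 0ℤ * t ≡ + 1 * 1ℤ * d + d * d * 0ℤ
  δ-coefficient = solve-∀
powδ-first-order t n c d {suc (suc j)} _
  with powδ-first-order t n c d {suc j} (s≤s z≤n)
... | U , V , eq =
  c * U - + suc j * c ^ j * n - d * V * n , c * V + d * U + + suc j * c ^ j * t + d * V * t ,
  trans (cong (mulδ (quad t n) (c , d)) eq)
        (cong₂ _,_ (scalar c d (c ^ j) (+ suc j) U V n) (δ-coefficient c d (c ^ j) (+ suc j) U V t))
  where
  scalar : ∀ c d C M U V n →
    c * (c * C + d * d * U) - d * (M * C * d + d * d * V) * n
    ≡ c * (c * C) + d * d * (c * U - M * C * n - d * V * n)
  scalar = solve-∀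
  δ-coefficient : ∀ c d C M U V t →
    c * (M * C * d + d * d * V) + d * (c * C + d * d * U) + d * (M * C * d + d * d * V) * t
    ≡ (1ℤ + M) * (c * C) * d + d * d * (c * V + d * U + M * C * t + d * V * t)
  δ-coefficient = solve-∀

C2-suc : ∀ m → suc m C 2 ≡ m C 2 ℕ.+ m
C2-suc m = begin
  suc m C 2          ≡⟨ nCk+nC[k+1]≡[n+1]C[k+1] m 1 ⟨
  m C 1 ℕ.+ m C 2    ≡⟨ cong (ℕ._+ m C 2) (nC1≡n m) ⟩
  m ℕ.+ m C 2        ≡⟨ ℕ.+-comm m (m C 2) ⟩
  m C 2 ℕ.+ m        ∎
  where open ≡-Reasoning

C2-double : ∀ m → (m C 2) ℕ.* 2 ≡ m ℕ.* ℕ.pred m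
C2-double zero    = refl
C2-double (suc m) = begin
  (suc m C 2) ℕ.* 2              ≡⟨ cong (ℕ._* 2) (C2-suc m) ⟩
  (m C 2 ℕ.+ m) ℕ.* 2            ≡⟨ ℕ.*-distribʳ-+ 2 (m C 2) m ⟩
  (m C 2) ℕ.* 2 ℕ.+ m ℕ.* 2      ≡⟨ cong (ℕ._+ m ℕ.* 2) (C2-double m) ⟩
  m ℕ.* ℕ.pred m ℕ.+ m ℕ.* 2     ≡⟨ step m ⟩
  suc m ℕ.* m                    ∎
  where
  open ≡-Reasoning
  identity : ∀ k → (1 ℕ.+ k) ℕ.* k ℕ.+ (1 ℕ.+ k) ℕ.* 2 ≡ (2 ℕ.+ k) ℕ.* (1 ℕ.+ k)
  identity = ℕ-solve-∀
  step : ∀ m → m ℕ.* ℕ.pred m ℕ.+ m ℕ.* 2 ≡ suc m ℕ.* m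
  step zero    = refl
  step (suc k) = identity k

powδ-second-order : ∀ t n c d {m} → 2 ≤ m → ∃₂ λ U V →
  powδ (quad t n) (c , d) m ≡
    (c ^ m + d * d * U ,
     + m * c ^ (m ℕ.∸ 1) * d + + (m C 2) * c ^ (m ℕ.∸ 2) * (d * d) * t + d * d * d * V)
powδ-second-order t n c d {suc zero} (s≤s ())
powδ-second-order t n c d {suc (suc zero)} _ =
  - n , 0ℤ , cong₂ _,_ (scalar c d t n) (δ-coefficient c d t n)
  where
  scalar : ∀ c d t n →
    c * (c * 1ℤ - d * 0ℤ * n) - d * (c * 0ℤ + d * 1ℤ + d * 0ℤ * t) * n ≡ c * (c * 1ℤ) + d * d * - n
  scalar = solve-∀
  δ-coefficient : ∀ c d t n →
    c * (c * 0ℤ + d * 1ℤ + d * 0ℤ * t) + d * (c * 1ℤ - d * 0ℤ * n)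
      + d * (c * 0ℤ + d * 1ℤ + d * 0ℤ * t) * t
    ≡ + 2 * (c * 1ℤ) * d + + 1 * 1ℤ * (d * d) * t + d * d * d * 0ℤ
  δ-coefficient = solve-∀
powδ-second-order t n c d {suc (suc (suc j))} _
  with powδ-second-order t n c d {suc (suc j)} (s≤s (s≤s z≤n))
... | U , V , eq rewrite C2-suc (suc (suc j)) =
  c * U - M * (c * cʲ) * n - T * cʲ * d * t * n - d * d * V * n ,
  c * V + U + T * cʲ * t * t + d * V * t ,
  trans (cong (mulδ (quad t n) (c , d)) eq)
        (cong₂ _,_ (scalar c d cʲ M T U V t n) (δ-coefficient c d cʲ M T U V t n))
  where
  cʲ = c ^ j
  M = + suc (suc j)
  T = + (suc (suc j) C 2)
  scalar : ∀ c d C M T U V t n →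
    c * (c * (c * C) + d * d * U) - d * (M * (c * C) * d + T * C * (d * d) * t + d * d * d * V) * n
    ≡ c * (c * (c * C)) + d * d * (c * U - M * (c * C) * n - T * C * d * t * n - d * d * V * n)
  scalar = solve-∀
  δ-coefficient : ∀ c d C M T U V t n →
    c * (M * (c * C) * d + T * C * (d * d) * t + d * d * d * V) + d * (c * (c * C) + d * d * U)
      + d * (M * (c * C) * d + T * C * (d * d) * t + d * d * d * V) * t
    ≡ (1ℤ + M) * (c * (c * C)) * d + (T + M) * (c * C) * (d * d) * t
      + d * d * d * (c * V + U + T * C * t * t + d * V * t)
  δ-coefficient = solve-∀

-- Integer arithmetic, multiplicative orders and parity

^-*-assocʳ : ∀ a e l → (a ^ e) ^ l ≡ a ^ (l ℕ.* e)
^-*-assocʳ a e l = trans (ℤ.^-*-assoc a e l) (cong (a ^_) (ℕ.*-comm e l))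

x*y-1≡x[y-1]+[x-1] : ∀ x y → x * y - 1ℤ ≡ x * (y - 1ℤ) + (x - 1ℤ)
x*y-1≡x[y-1]+[x-1] = solve-∀

x-1∣x^l-1 : ∀ {m} x l → m Signed.∣ x - 1ℤ → m Signed.∣ x ^ l - 1ℤ
x-1∣x^l-1 x zero    _     = Signed.divides 0ℤ refl
x-1∣x^l-1 x (suc l) m∣x-1 =
  subst (_ Signed.∣_) (sym (x*y-1≡x[y-1]+[x-1] x (x ^ l)))
        (Signed.∣m∣n⇒∣m+n (Signed.∣n⇒∣m*n x (x-1∣x^l-1 x l m∣x-1)) m∣x-1)

order-∣ : ∀ {m a e k} → IsMultOrder m a e → (+ m) ∣ a ^ k - 1ℤ → e ℕ.∣ k
order-∣ {m} {a} {suc e} {k} (_ , m∣aᵉ-1 , minimal) m∣aᵏ-1 =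
  ℕ.m%n≡0⇒n∣m k (suc e) remainder≡0
  where
  r = k % suc e
  l = k ℕ./ suc e
  aᵏ-1≡ : a ^ k - 1ℤ ≡ a ^ r * ((a ^ suc e) ^ l - 1ℤ) + (a ^ r - 1ℤ)
  aᵏ-1≡ = begin
    a ^ k - 1ℤ
      ≡⟨ cong (λ i → a ^ i - 1ℤ) (ℕ.m≡m%n+[m/n]*n k (suc e)) ⟩
    a ^ (r ℕ.+ l ℕ.* suc e) - 1ℤ
      ≡⟨ cong (_- 1ℤ) (ℤ.^-distribˡ-+-* a r (l ℕ.* suc e)) ⟩
    a ^ r * a ^ (l ℕ.* suc e) - 1ℤ
      ≡⟨ cong (λ x → a ^ r * x - 1ℤ) (^-*-assocʳ a (suc e) l) ⟨
    a ^ r * (a ^ suc e) ^ l - 1ℤ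
      ≡⟨ x*y-1≡x[y-1]+[x-1] (a ^ r) ((a ^ suc e) ^ l) ⟩
    a ^ r * ((a ^ suc e) ^ l - 1ℤ) + (a ^ r - 1ℤ)
      ∎
    where open ≡-Reasoning
  m∣aʳ-1 : (+ m) Signed.∣ a ^ r - 1ℤ
  m∣aʳ-1 = Signed.∣m+n∣m⇒∣n (subst (_ Signed.∣_) aᵏ-1≡ (Signed.∣ᵤ⇒∣ m∣aᵏ-1))
             (Signed.∣n⇒∣m*n (a ^ r) (x-1∣x^l-1 (a ^ suc e) l (Signed.∣ᵤ⇒∣ m∣aᵉ-1)))
  remainder≡0 : r ≡ 0
  remainder≡0 with r ℕ.≟ 0
  ... | yes r≡0 = r≡0
  ... | no  r≢0 = ⊥-elim (minimal r (ℕ.n≢0⇒n>0 r≢0) (ℕ.m%n<n k (suc e)) (Signed.∣⇒∣ᵤ m∣aʳ-1))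

odd-≡1+2* : ∀ {a} → ¬ (+ 2) Signed.∣ a → ∃[ u ] a ≡ 1ℤ + u * + 2
odd-≡1+2* {a} 2∤a with a %ℕ 2 | n%ℕd<d a 2 | a≡a%ℕn+[a/ℕn]*n a 2
... | 0           | _             | a≡ =
  ⊥-elim (2∤a (Signed.divides (a /ℕ 2) (trans a≡ (ℤ.+-identityˡ _))))
... | 1           | _             | a≡ = a /ℕ 2 , a≡
... | suc (suc _) | s≤s (s≤s ()) | _

odd⇒2∣-1 : ∀ {a} → ¬ (+ 2) Signed.∣ a → (+ 2) Signed.∣ a - 1ℤ
odd⇒2∣-1 2∤a with odd-≡1+2* 2∤a
... | u , refl = Signed.divides u (identity u)
  where
  identity : ∀ u → 1ℤ + u * + 2 - 1ℤ ≡ u * + 2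
  identity = solve-∀

odd⇒4∣²-1 : ∀ {a} → ¬ (+ 2) Signed.∣ a → (+ 4) Signed.∣ a ^ 2 - 1ℤ
odd⇒4∣²-1 2∤a with odd-≡1+2* 2∤a
... | u , refl = Signed.divides (u * (u + 1ℤ)) (identity u)
  where
  identity : ∀ u → (1ℤ + u * + 2) * ((1ℤ + u * + 2) * 1ℤ) - 1ℤ ≡ u * (u + 1ℤ) * + 4
  identity = solve-∀

1+r≤r+r : ∀ {r} → 1 ≤ r → suc r ≤ r ℕ.+ r
1+r≤r+r {r} = ℕ.+-monoˡ-≤ r

2+r≤r+r+r : ∀ {r} → 1 ≤ r → suc (suc r) ≤ r ℕ.+ r ℕ.+ r
2+r≤r+r+r {r} 1≤r = subst (_≤ r ℕ.+ r ℕ.+ r) (ℕ.+-comm (suc r) 1) (ℕ.+-mono-≤ (1+r≤r+r 1≤r) 1≤r)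

1≤∧≢1⇒2≤ : ∀ {r} → 1 ≤ r → r ≢ 1 → 2 ≤ r
1≤∧≢1⇒2≤ {suc zero}    _ r≢1 = contradiction refl r≢1
1≤∧≢1⇒2≤ {suc (suc r)} _ _   = s≤s (s≤s z≤n)

-- Comparisons in ℤ ∪ {+∞}

GtSub-finite⇔ : ∀ x y s → GtSub (just x) (just (y ℕ.+ s)) s ⇔ y < x
GtSub-finite⇔ x y s =
  mk⇔ (ℤ.drop‿+<+ ∘ subst (ℤ._< + x) (cancel (+ y) (+ s)))
      (subst (ℤ._< + x) (sym (cancel (+ y) (+ s))) ∘ ℤ.+<+)
  where
  cancel : ∀ Y S → Y + S - S ≡ Y
  cancel = solve-∀

GtSub₂-finite⇔ : ∀ ρ ε σ s → GtSub₂ (just ρ) ε (just (σ ℕ.+ s)) s ⇔ σ ℕ.+ ε < ρ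
GtSub₂-finite⇔ ρ ε σ s = mk⇔ to from
  where
  cancel : ∀ Y S → Y + S - S ≡ Y
  cancel = solve-∀
  uncancel : ∀ Y S → Y - S + S ≡ Y
  uncancel = solve-∀
  to : GtSub₂ (just ρ) ε (just (σ ℕ.+ s)) s → σ ℕ.+ ε < ρ
  to h = ℤ.drop‿+<+ (subst (+ (σ ℕ.+ ε) ℤ.<_) (uncancel (+ ρ) (+ ε))
           (ℤ.+-monoˡ-< (+ ε) (subst (ℤ._< + ρ - + ε) (cancel (+ σ) (+ s)) h)))
  from : σ ℕ.+ ε < ρ → GtSub₂ (just ρ) ε (just (σ ℕ.+ s)) s
  from h = subst (ℤ._< + ρ - + ε) (trans (cancel (+ σ) (+ ε)) (sym (cancel (+ σ) (+ s))))
             (ℤ.+-monoˡ-< (- + ε) (ℤ.+<+ h))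

GtSub-∞ : ∀ x c → ¬ GtSub x nothing c
GtSub-∞ nothing  c ()
GtSub-∞ (just x) c ()

GtSub₂-∞ : ∀ x d c → ¬ GtSub₂ x d nothing c
GtSub₂-∞ nothing  d c ()
GtSub₂-∞ (just x) d c ()

-- p-adic valuations

vℕ-go-∣ : ∀ f {p} m .{{_ : NonZero p}} → p ℕ.∣ m → vℕ-go (suc f) p m ≡ suc (vℕ-go f p (m ℕ./ p))
vℕ-go-∣ f {suc q} m p∣m with suc q ℕ.∣? m
... | yes _   = refl
... | no  p∤m = contradiction p∣m p∤m

vℕ-go-∤ : ∀ f {p} m .{{_ : NonZero p}} → ¬ p ℕ.∣ m → vℕ-go (suc f) p m ≡ 0
vℕ-go-∤ f {suc q} m p∤m with suc q ℕ.∣? m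
... | yes p∣m = contradiction p∣m p∤m
... | no  _   = refl

module _ {p : ℕ} (p-prime : Prime p) where

  private
    instance
      p-nonZero : NonZero p
      p-nonZero = prime⇒nonZero p-prime

    variable
      a b c d g q t n u w x z A ak bk : ℤ
      y : ZDelta
      δ : QuadInt
      e i j k m r s ρ σ κ : ℕ

  1<p : 1 < p
  1<p = ℕ.nonTrivial⇒n>1 p {{prime⇒nonTrivial p-prime}}

  infix 4 p^_∣_

  -- A record rather than a synonym, so that r can be recovered by unification.
  record p^_∣_ (r : ℕ) (z : ℤ) : Set where
    constructor p^-divides
    field
      signed : + (p ℕ.^ r) Signed.∣ z

  p^∣⇒∣abs : p^ r ∣ z → p ℕ.^ r ℕ.∣ ℤ.∣ z ∣
  p^∣⇒∣abs {r} {z} (p^-divides h) = Signed.∣⇒∣ᵤ {+ (p ℕ.^ r)} {z} h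

  ∣abs⇒p^∣ : p ℕ.^ r ℕ.∣ ℤ.∣ z ∣ → p^ r ∣ z
  ∣abs⇒p^∣ {r} {z} h = p^-divides (Signed.∣ᵤ⇒∣ {+ (p ℕ.^ r)} {z} h)

  p∣⇒p^1∣ : (+ p) ∣ z → p^ 1 ∣ z
  p∣⇒p^1∣ {z} p∣z = ∣abs⇒p^∣ (subst (ℕ._∣ ℤ.∣ z ∣) (sym (ℕ.*-identityʳ p)) p∣z)

  p^1∣⇒p∣ : p^ 1 ∣ z → (+ p) ∣ z
  p^1∣⇒p∣ {z} p∣z = subst (ℕ._∣ ℤ.∣ z ∣) (ℕ.*-identityʳ p) (p^∣⇒∣abs p∣z)

  p^0∣ : p^ 0 ∣ z
  p^0∣ {z} = p^-divides (Signed.divides z (sym (ℤ.*-identityʳ z)))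

  p^∣0 : p^ r ∣ 0ℤ
  p^∣0 = p^-divides (Signed.divides 0ℤ refl)

  p^∣-+ : p^ r ∣ u → p^ r ∣ w → p^ r ∣ u + w
  p^∣-+ (p^-divides h₁) (p^-divides h₂) = p^-divides (Signed.∣m∣n⇒∣m+n h₁ h₂)

  p^∣-cancelʳ : p^ r ∣ u + w → p^ r ∣ w → p^ r ∣ u
  p^∣-cancelʳ (p^-divides h₁) (p^-divides h₂) = p^-divides (Signed.∣m+n∣n⇒∣m h₁ h₂)

  p^∣-*ˡ : ∀ x → p^ r ∣ w → p^ r ∣ x * w
  p^∣-*ˡ x (p^-divides h) = p^-divides (Signed.∣n⇒∣m*n x h)

  p^∣-*ʳ : ∀ x → p^ r ∣ u → p^ r ∣ u * x
  p^∣-*ʳ x (p^-divides h) = p^-divides (Signed.∣m⇒∣m*n x h)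

  p^∣-mono : j ≤ r → p^ r ∣ z → p^ j ∣ z
  p^∣-mono {j} {r} j≤r (p^-divides h) =
    p^-divides (Signed.∣-trans (Signed.∣ᵤ⇒∣ {+ (p ℕ.^ j)} {+ (p ℕ.^ r)} p^j∣p^r) h)
    where
    p^j∣p^r : p ℕ.^ j ℕ.∣ p ℕ.^ r
    p^j∣p^r = subst (p ℕ.^ j ℕ.∣_)
      (trans (sym (ℕ.^-distribˡ-+-* p j (r ℕ.∸ j))) (cong (p ℕ.^_) (ℕ.m+[n∸m]≡n j≤r)))
      (ℕ.m∣m*n (p ℕ.^ (r ℕ.∸ j)))

  p^∣-* : p^ i ∣ u → p^ j ∣ w → p^ (i ℕ.+ j) ∣ u * w
  p^∣-* {i} {u} {j} {w} p^i∣u p^j∣w = ∣abs⇒p^∣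
    (subst₂ ℕ._∣_ (sym (ℕ.^-distribˡ-+-* p i j)) (sym (ℤ.abs-* u w))
            (ℕ.*-pres-∣ (p^∣⇒∣abs p^i∣u) (p^∣⇒∣abs p^j∣w)))

  record _HasValuation_ (z : ℤ) (r : ℕ) : Set where
    field
      divisible : p^ r ∣ z
      maximal   : ¬ p^ suc r ∣ z

  open _HasValuation_

  infix 4 _HasValuation_

  hasValuation-≤ : z HasValuation r → p^ j ∣ z → j ≤ r
  hasValuation-≤ {r = r} {j = j} z-val p^j∣z with j ℕ.≤? r
  ... | yes j≤r = j≤r
  ... | no  j≰r = ⊥-elim (maximal z-val (p^∣-mono (ℕ.≰⇒> j≰r) p^j∣z))

  hasValuation-unique : z HasValuation r → z HasValuation s → r ≡ s
  hasValuation-unique z-r z-s =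
    ℕ.≤-antisym (hasValuation-≤ z-s (divisible z-r)) (hasValuation-≤ z-r (divisible z-s))

  hasValuation⇒≢0 : z HasValuation r → z ≢ 0ℤ
  hasValuation⇒≢0 z-val refl = maximal z-val p^∣0

  hasValuation-+ : u HasValuation r → p^ suc r ∣ w → (u + w) HasValuation r
  hasValuation-+ u-val p^1+r∣w = record
    { divisible = p^∣-+ (divisible u-val) (p^∣-mono (ℕ.n≤1+n _) p^1+r∣w)
    ; maximal   = λ p^1+r∣u+w → maximal u-val (p^∣-cancelʳ p^1+r∣u+w p^1+r∣w)
    }

  p∤⇒unit : ¬ (+ p) ∣ z → z HasValuation 0
  p∤⇒unit p∤z = record { divisible = p^0∣ ; maximal = p∤z ∘ p^1∣⇒p∣ }

  1-unit : 1ℤ HasValuation 0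
  1-unit = p∤⇒unit (λ p∣1 → ℕ.<⇒≢ 1<p (sym (ℕ.∣1⇒≡1 p∣1)))

  unit-* : u HasValuation 0 → w HasValuation 0 → (u * w) HasValuation 0
  unit-* {u} {w} u-unit w-unit = p∤⇒unit p∤uw
    where
    p∤uw : ¬ (+ p) ∣ u * w
    p∤uw p∣uw with euclidsLemma ℤ.∣ u ∣ ℤ.∣ w ∣ p-prime (subst (p ℕ.∣_) (ℤ.abs-* u w) p∣uw)
    ... | inj₁ p∣u = maximal u-unit (p∣⇒p^1∣ p∣u)
    ... | inj₂ p∣w = maximal w-unit (p∣⇒p^1∣ p∣w)

  unit-^ : a HasValuation 0 → (a ^ m) HasValuation 0
  unit-^ {m = zero}  _      = 1-unit
  unit-^ {m = suc m} a-unit = unit-* a-unit (unit-^ {m = m} a-unit)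

  unit-*-p^ : w HasValuation 0 → (w * + (p ℕ.^ r)) HasValuation r
  unit-*-p^ {w} {r} w-unit = record
    { divisible = p^∣-*ˡ w (p^-divides Signed.∣-refl)
    ; maximal   = λ p^1+r∣wp^r → maximal w-unit (p∣⇒p^1∣ {w}
        (ℕ.*-cancelʳ-∣ (p ℕ.^ r) {{ℕ.m^n≢0 p r}}
          (subst (p ℕ.* p ℕ.^ r ℕ.∣_) (ℤ.abs-* w (+ (p ℕ.^ r))) (p^∣⇒∣abs p^1+r∣wp^r))))
    }

  hasValuation⇒unit-part : z HasValuation r → ∃[ w ] w HasValuation 0 × z ≡ w * + (p ℕ.^ r)
  hasValuation⇒unit-part {z} {r} z-val with divisible z-val
  ... | p^-divides (Signed.divides w z≡wp^r) = w , p∤⇒unit p∤w , z≡wp^r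
    where
    p∤w : ¬ (+ p) ∣ w
    p∤w p∣w = maximal z-val
      (subst (p^ suc r ∣_) (sym z≡wp^r) (p^∣-* {u = w} (p∣⇒p^1∣ p∣w) (p^-divides Signed.∣-refl)))

  hasValuation-* : u HasValuation r → w HasValuation s → (u * w) HasValuation (r ℕ.+ s)
  hasValuation-* {r = r} {s = s} u-val w-val
    with hasValuation⇒unit-part u-val | hasValuation⇒unit-part w-val
  ... | u′ , u′-unit , refl | w′ , w′-unit , refl =
    subst (_HasValuation (r ℕ.+ s)) (sym regroup) (unit-*-p^ (unit-* u′-unit w′-unit))
    where
    swap : ∀ u w X Y → u * X * (w * Y) ≡ u * w * (X * Y)
    swap = solve-∀
    regroup : u′ * + (p ℕ.^ r) * (w′ * + (p ℕ.^ s)) ≡ u′ * w′ * + (p ℕ.^ (r ℕ.+ s))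
    regroup = trans (swap u′ w′ _ _)
      (cong (u′ * w′ *_) (trans (sym (ℤ.pos-* (p ℕ.^ r) (p ℕ.^ s)))
                                (cong +_ (sym (ℕ.^-distribˡ-+-* p r s)))))

  p-hasValuation : (+ p) HasValuation 1
  p-hasValuation =
    subst (_HasValuation 1) (trans (ℤ.*-identityˡ _) (cong +_ (ℕ.*-identityʳ p))) (unit-*-p^ 1-unit)

  hasValuation-*p : w HasValuation r → (w * + p) HasValuation suc r
  hasValuation-*p {w} {r} w-val =
    subst (w * + p HasValuation_) (ℕ.+-comm r 1) (hasValuation-* {w} {r} {+ p} w-val p-hasValuation)

  vℕ-go-hasValuation : ∀ f m .{{_ : NonZero m}} → m ≤ f → (+ m) HasValuation vℕ-go f p m
  vℕ-go-hasValuation zero    (suc m) ()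
  vℕ-go-hasValuation (suc f) m m≤1+f with p ℕ.∣? m
  ... | no  p∤m rewrite vℕ-go-∤ f m p∤m = p∤⇒unit p∤m
  ... | yes p∣m rewrite vℕ-go-∣ f m p∣m =
    subst (_HasValuation suc (vℕ-go f p (m ℕ./ p))) m/p*p≡m
      (hasValuation-*p (vℕ-go-hasValuation f (m ℕ./ p) {{m/p≢0}} m/p≤f))
    where
    m/p≢0 : NonZero (m ℕ./ p)
    m/p≢0 = ℕ.>-nonZero (ℕ.m≥n⇒m/n>0 (ℕ.∣⇒≤ p∣m))
    m/p≤f : m ℕ./ p ≤ f
    m/p≤f = ℕ.≤-pred (ℕ.≤-trans (ℕ.m/n<m m p 1<p) m≤1+f)
    m/p*p≡m : + (m ℕ./ p) * + p ≡ + m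
    m/p*p≡m = trans (sym (ℤ.pos-* (m ℕ./ p) p)) (cong +_ (ℕ.m/n*n≡m p∣m))

  vℕ-go-hasValuation-abs : ℤ.∣ z ∣ ≡ suc m → z HasValuation vℕ-go (suc m) p (suc m)
  vℕ-go-hasValuation-abs {z} {m} ∣z∣≡1+m = record
    { divisible = ∣abs⇒p^∣ (subst (_ ℕ.∣_) (sym ∣z∣≡1+m) (p^∣⇒∣abs (divisible val)))
    ; maximal   = maximal val ∘ ∣abs⇒p^∣ ∘ subst (_ ℕ.∣_) ∣z∣≡1+m ∘ p^∣⇒∣abs
    }
    where
    val = vℕ-go-hasValuation (suc m) (suc m) ℕ.≤-refl

  ∃-hasValuation : z ≢ 0ℤ → ∃[ r ] z HasValuation r
  ∃-hasValuation {z} z≢0 with ℤ.∣ z ∣ in ∣z∣≡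
  ... | zero  = ⊥-elim (z≢0 (ℤ.∣i∣≡0⇒i≡0 ∣z∣≡))
  ... | suc m = _ , vℕ-go-hasValuation-abs ∣z∣≡

  ∃-hasValuation-ℕ : 1 ≤ m → ∃[ r ] (+ m) HasValuation r
  ∃-hasValuation-ℕ 1≤m = ∃-hasValuation (λ m≡0 → ℕ.<⇒≢ 1≤m (sym (ℤ.+-injective m≡0)))

  hasValuation⇒vp : z HasValuation r → vp p z ≡ just r
  hasValuation⇒vp {z} z-val with ℤ.∣ z ∣ in ∣z∣≡
  ... | zero  = ⊥-elim (hasValuation⇒≢0 z-val (ℤ.∣i∣≡0⇒i≡0 ∣z∣≡))
  ... | suc m = cong just (hasValuation-unique (vℕ-go-hasValuation-abs ∣z∣≡) z-val)

  hasValuation⇒vpNZ : z HasValuation r → vpNZ p z ≡ r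
  hasValuation⇒vpNZ {z} z-val with vp p z | hasValuation⇒vp z-val
  ... | just r | refl = refl

  hasValuation-*p⁻¹ : (w * + p) HasValuation suc r → w HasValuation r
  hasValuation-*p⁻¹ {w} wp-val
    with ∃-hasValuation {w} (λ { refl → hasValuation⇒≢0 wp-val refl })
  ... | s , w-val =
    subst (w HasValuation_) (ℕ.suc-injective (hasValuation-unique (hasValuation-*p w-val) wp-val)) w-val

  GtSub-vp⇔ : ∀ x X s → GtSub (vp p x) (just (X ℕ.+ s)) s ⇔ p^ suc X ∣ x
  GtSub-vp⇔ x X s with x ℤ.≟ 0ℤ
  ... | yes refl = mk⇔ (λ _ → p^∣0) (λ _ → tt)
  ... | no  x≢0 with ∃-hasValuation x≢0
  ... | r , x-val rewrite hasValuation⇒vp x-val =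
    ⇔.trans (GtSub-finite⇔ r X s) (mk⇔ (λ X<r → p^∣-mono X<r (divisible x-val)) (hasValuation-≤ x-val))

  -- Splitting on this rather than on p ℕ.≟ 2 keeps `with` from abstracting inside orderModulus p.
  p≡2⊎p≢2 : p ≡ 2 ⊎ p ≢ 2
  p≡2⊎p≢2 with p ℕ.≟ 2
  ... | yes p≡2 = inj₁ p≡2
  ... | no  p≢2 = inj₂ p≢2

  orderModulus-∣⇔ : orderModulus p ≡ p ℕ.^ j → (+ orderModulus p) ∣ z ⇔ p^ j ∣ z
  orderModulus-∣⇔ M≡p^j rewrite M≡p^j = mk⇔ ∣abs⇒p^∣ p^∣⇒∣abs

  orderModulus-odd : p ≢ 2 → orderModulus p ≡ p ℕ.^ 1
  orderModulus-odd p≢2 with p ℕ.≟ 2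
  ... | yes p≡2 = contradiction p≡2 p≢2
  ... | no  _   = sym (ℕ.*-identityʳ p)

  orderModulus-even : p ≡ 2 → orderModulus p ≡ p ℕ.^ 2
  orderModulus-even p≡2 with p ℕ.≟ 2
  ... | yes _   = cong (ℕ._^ 2) (sym p≡2)
  ... | no  p≢2 = contradiction p≡2 p≢2

  order-p²∣ : p ≡ 2 → IsMultOrder (orderModulus p) a e → p^ 2 ∣ a ^ e - 1ℤ
  order-p²∣ p≡2 (_ , M∣aᵉ-1 , _) =
    Equivalence.to (orderModulus-∣⇔ {2} (orderModulus-even p≡2)) M∣aᵉ-1

  order-p∣ : IsMultOrder (orderModulus p) a e → p^ 1 ∣ a ^ e - 1ℤ
  order-p∣ order@(_ , M∣aᵉ-1 , _) with p≡2⊎p≢2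
  ... | inj₁ p≡2 = p^∣-mono (s≤s z≤n) (order-p²∣ p≡2 order)
  ... | inj₂ p≢2 = Equivalence.to (orderModulus-∣⇔ {1} (orderModulus-odd p≢2)) M∣aᵉ-1

  p∣⇒order-∣ : p ≢ 2 → IsMultOrder (orderModulus p) a e → p^ 1 ∣ a ^ k - 1ℤ → e ℕ.∣ k
  p∣⇒order-∣ p≢2 order =
    order-∣ order ∘ Equivalence.from (orderModulus-∣⇔ {1} (orderModulus-odd p≢2))

  p²∣⇒order-∣ : p ≡ 2 → IsMultOrder (orderModulus p) a e → p^ 2 ∣ a ^ k - 1ℤ → e ℕ.∣ k
  p²∣⇒order-∣ p≡2 order =
    order-∣ order ∘ Equivalence.from (orderModulus-∣⇔ {2} (orderModulus-even p≡2))

  2^∣⇒p^∣ : p ≡ 2 → (+ (2 ℕ.^ j)) Signed.∣ z → p^ j ∣ z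
  2^∣⇒p^∣ {j} {z} p≡2 h = p^-divides (subst (λ x → + (x ℕ.^ j) Signed.∣ z) (sym p≡2) h)

  unit⇒odd : p ≡ 2 → a HasValuation 0 → ¬ (+ 2) Signed.∣ a
  unit⇒odd p≡2 a-unit 2∣a = maximal a-unit (2^∣⇒p^∣ {1} p≡2 2∣a)

  -- Powers of elements close to a scalar

  p^∣-square : j ≤ r ℕ.+ r → p^ r ∣ d → ∀ X → p^ j ∣ d * d * X
  p^∣-square j≤2r p^r∣d X = p^∣-mono j≤2r (p^∣-*ʳ X (p^∣-* p^r∣d p^r∣d))

  p^∣-cube : j ≤ r ℕ.+ r ℕ.+ r → p^ r ∣ d → ∀ X → p^ j ∣ d * d * d * X
  p^∣-cube j≤3r p^r∣d X = p^∣-mono j≤3r (p^∣-*ʳ X (p^∣-* (p^∣-* p^r∣d p^r∣d) p^r∣d))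

  record NearScalar (r : ℕ) (A : ℤ) (y : ZDelta) : Set where
    field
      δ-valuation      : proj₂ y HasValuation r
      scalar-congruent : p^ r ∣ proj₁ y - A
      scalar-unit      : proj₁ y HasValuation 0

  open NearScalar

  nearScalar-unit-exponent : 1 ≤ r → b HasValuation r → a HasValuation 0 → (+ m) HasValuation 0 →
                             NearScalar r (a ^ m) (powδ (quad t n) (a , b) m)
  nearScalar-unit-exponent {r} {b} {a} {m} {t} {n} 1≤r b-val a-unit m-unit
    with powδ-first-order t n a b (ℕ.n≢0⇒n>0 (hasValuation⇒≢0 m-unit ∘ cong (+_)))
  ... | U , V , eq = subst (NearScalar r (a ^ m)) (sym eq) record
    { δ-valuation      = hasValuation-+ leading (p^∣-square (1+r≤r+r 1≤r) b∣ V)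
    ; scalar-congruent = subst (p^ r ∣_) (sym (cancel (a ^ m) (b * b * U)))
                           (p^∣-square (ℕ.m≤m+n r r) b∣ U)
    ; scalar-unit      = hasValuation-+ (unit-^ {m = m} a-unit)
                           (p^∣-square (ℕ.≤-trans 1≤r (ℕ.m≤m+n r r)) b∣ U)
    }
    where
    b∣ = divisible b-val
    leading : (+ m * a ^ (m ℕ.∸ 1) * b) HasValuation r
    leading = hasValuation-* (unit-* m-unit (unit-^ {m = m ℕ.∸ 1} a-unit)) b-val
    cancel : ∀ x y → x + y - x ≡ y
    cancel = solve-∀

  -- In ℤ[ε] with ε² = ε we have (A + hε)^p = A^p + ((A + h)^p - A^p)ε, so the first-order
  -- expansion in h reads c^p - A^p = p A^(p-1) h + h² V for h = c - A.
  ^p-congruence : 1 ≤ r → p^ r ∣ c - A → p^ suc r ∣ c ^ p - A ^ p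
  ^p-congruence {r} {c} {A} 1≤r p^r∣h with powδ-first-order (+ 1) 0ℤ A (c - A) (ℕ.<⇒≤ 1<p)
  ... | U , V , eq = subst (p^ suc r ∣_) expansion
    (p^∣-+ (p^∣-* (p^∣-*ʳ (A ^ (p ℕ.∸ 1)) (divisible p-hasValuation)) p^r∣h)
           (p^∣-square (1+r≤r+r 1≤r) p^r∣h V))
    where
    open ≡-Reasoning
    cancel : ∀ A c → A + (c - A) ≡ c
    cancel = solve-∀
    expansion : + p * A ^ (p ℕ.∸ 1) * (c - A) + (c - A) * (c - A) * V ≡ c ^ p - A ^ p
    expansion = begin
      + p * A ^ (p ℕ.∸ 1) * (c - A) + (c - A) * (c - A) * V ≡⟨ cong proj₂ eq ⟨
      proj₂ (powδ (quad (+ 1) 0ℤ) (A , c - A) p)          ≡⟨ cong proj₂ (powδ-idempotent A (c - A) p) ⟩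
      (A + (c - A)) ^ p - A ^ p                             ≡⟨ cong (λ x → x ^ p - A ^ p) (cancel A c) ⟩
      c ^ p - A ^ p                                         ∎

  p∣pC2 : p ≢ 2 → p ℕ.∣ p C 2
  p∣pC2 p≢2
    with euclidsLemma (p C 2) 2 p-prime (subst (p ℕ.∣_) (sym (C2-double p)) (ℕ.m∣m*n (ℕ.pred p)))
  ... | inj₁ p∣pC2 = p∣pC2
  ... | inj₂ p∣2   = contradiction (ℕ.≤-antisym (ℕ.∣⇒≤ p∣2) 1<p) p≢2

  -- For odd p the factor C(p,2) supplies a power of p; for p = 2 it is 1 and r ≥ 2 compensates.
  p^∣-binomial-term : 1 ≤ r → (p ≡ 2 → 2 ≤ r) → p^ r ∣ d → ∀ X t →
                      p^ suc (suc r) ∣ + (p C 2) * X * (d * d) * t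
  p^∣-binomial-term {r} {d} 1≤r 2⇒2≤r p^r∣d X t with p ℕ.≟ 2
  ... | yes p≡2 = p^∣-*ʳ t (p^∣-*ˡ (+ (p C 2) * X)
                    (p^∣-mono (ℕ.+-monoˡ-≤ r (2⇒2≤r p≡2)) (p^∣-* p^r∣d p^r∣d)))
  ... | no  p≢2 = p^∣-*ʳ t (p^∣-mono (s≤s (1+r≤r+r 1≤r))
                    (p^∣-* (p^∣-*ʳ X (p∣⇒p^1∣ {+ (p C 2)} (p∣pC2 p≢2))) (p^∣-* p^r∣d p^r∣d)))

  nearScalar-^p : 1 ≤ r → (p ≡ 2 → 2 ≤ r) → NearScalar r A y →
                  NearScalar (suc r) (A ^ p) (powδ (quad t n) y p)
  nearScalar-^p {r} {A} {c , d} {t} {n} 1≤r 2⇒2≤r y-near with powδ-second-order t n c d 1<p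
  ... | U , V , eq = subst (NearScalar (suc r) (A ^ p)) (sym eq) record
    { δ-valuation      = hasValuation-+
                           (hasValuation-+ leading (p^∣-binomial-term 1≤r 2⇒2≤r d∣ (c ^ (p ℕ.∸ 2)) t))
                           (p^∣-cube (2+r≤r+r+r 1≤r) d∣ V)
    ; scalar-congruent = subst (p^ suc r ∣_) (sym (regroup (c ^ p) (d * d * U) (A ^ p)))
                           (p^∣-+ (^p-congruence 1≤r (scalar-congruent y-near))
                                  (p^∣-square (1+r≤r+r 1≤r) d∣ U))
    ; scalar-unit      = hasValuation-+ (unit-^ {m = p} (scalar-unit y-near))
                           (p^∣-square (ℕ.≤-trans 1≤r (ℕ.m≤m+n r r)) d∣ U)
    }
    where
    d∣ = divisible (δ-valuation y-near)
    leading : (+ p * c ^ (p ℕ.∸ 1) * d) HasValuation suc r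
    leading = hasValuation-* (hasValuation-* p-hasValuation (unit-^ {m = p ℕ.∸ 1} (scalar-unit y-near)))
                             (δ-valuation y-near)
    regroup : ∀ x y A → x + y - A ≡ (x - A) + y
    regroup = solve-∀

  nearScalar-power : 1 ≤ r → b HasValuation r → a HasValuation 0 → (+ k) HasValuation κ →
                     (p ≡ 2 → r ≡ 1 → κ ≡ 0) →
                     NearScalar (r ℕ.+ κ) (a ^ k) (powδ (quad t n) (a , b) k)
  nearScalar-power {r} {b} {a} {k} {zero} {t} {n} 1≤r b-val a-unit k-unit _ =
    subst (λ j → NearScalar j (a ^ k) (powδ (quad t n) (a , b) k)) (sym (ℕ.+-identityʳ r))
      (nearScalar-unit-exponent 1≤r b-val a-unit k-unit)
  nearScalar-power {r} {b} {a} {k} {suc κ} {t} {n} 1≤r b-val a-unit k-val exceptional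
    with p^1∣⇒p∣ (p^∣-mono (s≤s z≤n) (divisible k-val))
  ... | ℕ.divides k′ refl =
    subst₂ (λ j y → NearScalar j (a ^ (k′ ℕ.* p)) y)
           (sym (ℕ.+-suc r κ)) (sym (powδ-* (quad t n) (a , b) k′ p))
      (subst (λ A → NearScalar (suc (r ℕ.+ κ)) A (powδ (quad t n) (powδ (quad t n) (a , b) k′) p))
             (ℤ.^-*-assoc a k′ p)
        (nearScalar-^p {t = t} {n = n} (ℕ.≤-trans 1≤r (ℕ.m≤m+n r κ)) 2≤r+κ
          (nearScalar-power 1≤r b-val a-unit k′-val
            (λ p≡2 r≡1 → contradiction (exceptional p≡2 r≡1) ℕ.1+n≢0))))
    where
    k′-val : (+ k′) HasValuation κ
    k′-val = hasValuation-*p⁻¹ (subst (_HasValuation suc κ) (ℤ.pos-* k′ p) k-val)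
    2≤r+κ : p ≡ 2 → 2 ≤ r ℕ.+ κ
    2≤r+κ p≡2 = ℕ.≤-trans (1≤∧≢1⇒2≤ 1≤r (ℕ.1+n≢0 ∘ exceptional p≡2)) (ℕ.m≤m+n r κ)

  -- nearScalar-power in ℤ[ε] with ε² = ε, where (1 + (A - 1)ε)^k = 1 + (A^k - 1)ε.
  lifting-the-exponent : 1 ≤ ρ → (p ≡ 2 → 2 ≤ ρ) → (A - 1ℤ) HasValuation ρ → (+ k) HasValuation κ →
                         (A ^ k - 1ℤ) HasValuation (ρ ℕ.+ κ)
  lifting-the-exponent {ρ} {A} {k} {κ} 1≤ρ 2⇒2≤ρ A-1-val k-val =
    subst (_HasValuation (ρ ℕ.+ κ)) δ-part≡
      (δ-valuation (nearScalar-power {t = + 1} {n = 0ℤ} 1≤ρ A-1-val 1-unit k-val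
        (λ p≡2 ρ≡1 → contradiction (sym ρ≡1) (ℕ.<⇒≢ (2⇒2≤ρ p≡2)))))
    where
    cancel : ∀ A → 1ℤ + (A - 1ℤ) ≡ A
    cancel = solve-∀
    δ-part≡ : proj₂ (powδ (quad (+ 1) 0ℤ) (1ℤ , A - 1ℤ) k) ≡ A ^ k - 1ℤ
    δ-part≡ = trans (cong proj₂ (powδ-idempotent 1ℤ (A - 1ℤ) k))
                    (cong₂ _-_ (cong (_^ k) (cancel A)) (ℤ.^-zeroˡ k))

  OrderCondition : (a b g q : ℤ) (e k : ℕ) → Set
  OrderCondition a b g q e k =
    (GtSub₂ (vp p (a ^ e - 1ℤ)) (vpNZ p (+ e)) (vp p b) (vpNZ p g) × (+ e) ∣ (+ k))
    ⊎ (p ≡ 2 × vp 2 (+ k) ≡ just 0 × vp 2 q ≡ just 0)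

  hasValuation⇒vp₂ : p ≡ 2 → z HasValuation r → vp 2 z ≡ just r
  hasValuation⇒vp₂ {z} {r} p≡2 z-val = subst (λ x → vp x z ≡ just r) p≡2 (hasValuation⇒vp z-val)

  exceptional⇔ : (+ k) HasValuation κ → q HasValuation σ →
                 (p ≡ 2 × vp 2 (+ k) ≡ just 0 × vp 2 q ≡ just 0) ⇔ (p ≡ 2 × κ ≡ 0 × σ ≡ 0)
  exceptional⇔ k-val q-val = mk⇔
    (λ (p≡2 , vk , vq) → p≡2 , just-injective (trans (sym (hasValuation⇒vp₂ p≡2 k-val)) vk)
                             , just-injective (trans (sym (hasValuation⇒vp₂ p≡2 q-val)) vq))
    (λ (p≡2 , κ≡0 , σ≡0) → p≡2 , trans (hasValuation⇒vp₂ p≡2 k-val) (cong just κ≡0)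
                               , trans (hasValuation⇒vp₂ p≡2 q-val) (cong just σ≡0))

  GtSub₂-vp⇔ : x HasValuation ρ → (+ e) HasValuation r → b HasValuation (σ ℕ.+ s) → g HasValuation s →
               GtSub₂ (vp p x) (vpNZ p (+ e)) (vp p b) (vpNZ p g) ⇔ σ ℕ.+ r < ρ
  GtSub₂-vp⇔ {ρ = ρ} {r = r} {σ = σ} {s = s} x-val e-val b-val g-val
    rewrite hasValuation⇒vp x-val | hasValuation⇒vpNZ e-val | hasValuation⇒vp b-val | hasValuation⇒vpNZ g-val
    = GtSub₂-finite⇔ ρ r σ s

  p≡2∧odd⇒κ≡0 : p ≡ 2 → ¬ 2 ℕ.∣ k → (+ k) HasValuation κ → κ ≡ 0
  p≡2∧odd⇒κ≡0 {κ = zero}  _   _   _     = refl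
  p≡2∧odd⇒κ≡0 {κ = suc κ} p≡2 2∤k k-val =
    contradiction (subst (ℕ._∣ _) p≡2 (p^1∣⇒p∣ (p^∣-mono (s≤s z≤n) (divisible k-val)))) 2∤k

  -- Both sides amount to p = 2 and v(q) = 0: for odd p neither can hold, and for p = 2
  -- the order e divides 2, so k is odd.
  orderCondition-∤ : IsMultOrder (orderModulus p) a e → ¬ e ℕ.∣ k → a HasValuation 0 →
                     (+ k) HasValuation κ → q HasValuation σ →
                     OrderCondition a b g q e k ⇔ p^ suc (σ ℕ.+ κ) ∣ a ^ k - 1ℤ
  orderCondition-∤ {a} {e} {k} {κ} {q} {σ} {b} {g} order e∤k a-unit k-val q-val =
    ⇔.trans condition⇔ (⇔.sym divisibility⇔)
    where
    k-odd : p ≡ 2 → ¬ 2 ℕ.∣ k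
    k-odd p≡2 2∣k = e∤k (ℕ.∣-trans e∣2 2∣k)
      where
      e∣2 : e ℕ.∣ 2
      e∣2 = p²∣⇒order-∣ p≡2 order (2^∣⇒p^∣ {2} p≡2 (odd⇒4∣²-1 (unit⇒odd p≡2 a-unit)))
    κ≡0 : p ≡ 2 → κ ≡ 0
    κ≡0 p≡2 = p≡2∧odd⇒κ≡0 p≡2 (k-odd p≡2) k-val
    condition⇔ : OrderCondition a b g q e k ⇔ (p ≡ 2 × σ ≡ 0)
    condition⇔ = mk⇔
      (λ { (inj₁ (_ , e∣k)) → contradiction e∣k e∤k
         ; (inj₂ exceptional) → let p≡2 , _ , σ≡0 = Equivalence.to (exceptional⇔ k-val q-val) exceptional
                                in p≡2 , σ≡0 })
      (λ (p≡2 , σ≡0) → inj₂ (Equivalence.from (exceptional⇔ k-val q-val) (p≡2 , κ≡0 p≡2 , σ≡0)))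
    divisibility⇔ : p^ suc (σ ℕ.+ κ) ∣ a ^ k - 1ℤ ⇔ (p ≡ 2 × σ ≡ 0)
    divisibility⇔ = mk⇔ to from
      where
      to : p^ suc (σ ℕ.+ κ) ∣ a ^ k - 1ℤ → p ≡ 2 × σ ≡ 0
      to p^∣aᵏ-1 with p≡2⊎p≢2 | σ ℕ.≟ 0
      ... | inj₂ p≢2 | _       = contradiction (p∣⇒order-∣ p≢2 order (p^∣-mono (s≤s z≤n) p^∣aᵏ-1)) e∤k
      ... | inj₁ p≡2 | yes σ≡0 = p≡2 , σ≡0
      ... | inj₁ p≡2 | no  σ≢0 = contradiction
        (p²∣⇒order-∣ p≡2 order
          (p^∣-mono (s≤s (ℕ.≤-trans (ℕ.n≢0⇒n>0 σ≢0) (ℕ.m≤m+n σ κ))) p^∣aᵏ-1)) e∤k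
      from : p ≡ 2 × σ ≡ 0 → p^ suc (σ ℕ.+ κ) ∣ a ^ k - 1ℤ
      from (p≡2 , σ≡0) = subst (λ j → p^ suc j ∣ a ^ k - 1ℤ) (sym (cong₂ ℕ._+_ σ≡0 (κ≡0 p≡2)))
        (2^∣⇒p^∣ {1} p≡2 (odd⇒2∣-1 (unit⇒odd p≡2 (unit-^ {m = k} a-unit))))

  orderCondition-aᵉ≡1 : a ^ e - 1ℤ ≡ 0ℤ → e ℕ.∣ k → b HasValuation r →
                        OrderCondition a b g q e k × p^ j ∣ a ^ k - 1ℤ
  orderCondition-aᵉ≡1 {a} {e} {b = b} {g = g} {j = j} aᵉ-1≡0 e∣k@(ℕ.divides l refl) b-val =
    inj₁ (unbounded , e∣k) , subst (p^ j ∣_) (sym aᵏ-1≡0) p^∣0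
    where
    aᵏ-1≡0 : a ^ (l ℕ.* e) - 1ℤ ≡ 0ℤ
    aᵏ-1≡0 = begin
      a ^ (l ℕ.* e) - 1ℤ    ≡⟨ cong (_- 1ℤ) (^-*-assocʳ a e l) ⟨
      (a ^ e) ^ l - 1ℤ      ≡⟨ cong (λ x → x ^ l - 1ℤ) (ℤ.i-j≡0⇒i≡j (a ^ e) 1ℤ aᵉ-1≡0) ⟩
      1ℤ ^ l - 1ℤ           ≡⟨ cong (_- 1ℤ) (ℤ.^-zeroˡ l) ⟩
      0ℤ                    ∎
      where open ≡-Reasoning
    unbounded : GtSub₂ (vp p (a ^ e - 1ℤ)) (vpNZ p (+ e)) (vp p b) (vpNZ p g)
    unbounded rewrite aᵉ-1≡0 | hasValuation⇒vp b-val = tt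

  orderCondition-LTE : IsMultOrder (orderModulus p) a e → (a ^ e - 1ℤ) HasValuation ρ → e ℕ.∣ k →
                       (+ k) HasValuation κ → q HasValuation σ → b HasValuation (σ ℕ.+ s) → g HasValuation s →
                       OrderCondition a b g q e k ⇔ p^ suc (σ ℕ.+ κ) ∣ a ^ k - 1ℤ
  orderCondition-LTE {a} {e} {ρ} {k} {κ} {q} {σ} {b} {s} {g}
                     order ρ-val e∣k@(ℕ.divides l refl) k-val q-val b-val g-val
    with ∃-hasValuation-ℕ (proj₁ order)
       | ∃-hasValuation-ℕ (ℕ.n≢0⇒n>0 (λ { refl → hasValuation⇒≢0 k-val refl }))
  ... | ε , ε-val | μ , μ-val = ⇔.trans condition⇔ (⇔.sym divisibility⇔)
    where
    1≤ρ : 1 ≤ ρ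
    1≤ρ = hasValuation-≤ ρ-val (order-p∣ order)
    κ≡μ+ε : κ ≡ μ ℕ.+ ε
    κ≡μ+ε = hasValuation-unique k-val
      (subst (_HasValuation (μ ℕ.+ ε)) (sym (ℤ.pos-* l e)) (hasValuation-* {+ l} {μ} {+ e} μ-val ε-val))
    aᵏ-1-val : (a ^ (l ℕ.* e) - 1ℤ) HasValuation (ρ ℕ.+ μ)
    aᵏ-1-val = subst (_HasValuation (ρ ℕ.+ μ)) (cong (_- 1ℤ) (^-*-assocʳ a e l))
      (lifting-the-exponent 1≤ρ (λ p≡2 → hasValuation-≤ ρ-val (order-p²∣ p≡2 order)) ρ-val μ-val)
    condition⇔ : OrderCondition a b g q e (l ℕ.* e) ⇔ σ ℕ.+ ε < ρ
    condition⇔ = mk⇔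
      (λ { (inj₁ (gt , _)) → Equivalence.to (GtSub₂-vp⇔ ρ-val ε-val b-val g-val) gt
         ; (inj₂ exceptional) →
             let _ , κ≡0 , σ≡0 = Equivalence.to (exceptional⇔ k-val q-val) exceptional
                 ε≡0 = ℕ.m+n≡0⇒n≡0 μ (trans (sym κ≡μ+ε) κ≡0)
             in subst (_< ρ) (sym (cong₂ ℕ._+_ σ≡0 ε≡0)) 1≤ρ })
      (λ σ+ε<ρ → inj₁ (Equivalence.from (GtSub₂-vp⇔ ρ-val ε-val b-val g-val) σ+ε<ρ , e∣k))
    regroup : ∀ σ μ ε → σ ℕ.+ (μ ℕ.+ ε) ≡ σ ℕ.+ ε ℕ.+ μ
    regroup = ℕ-solve-∀
    divisibility⇔ : p^ suc (σ ℕ.+ κ) ∣ a ^ (l ℕ.* e) - 1ℤ ⇔ σ ℕ.+ ε < ρ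
    divisibility⇔ rewrite κ≡μ+ε | regroup σ μ ε =
      mk⇔ (ℕ.+-cancelʳ-≤ μ (suc (σ ℕ.+ ε)) ρ ∘ hasValuation-≤ aᵏ-1-val)
          (λ σ+ε<ρ → p^∣-mono (ℕ.+-monoˡ-≤ μ σ+ε<ρ) (divisible aᵏ-1-val))

  orderCondition-∣ : IsMultOrder (orderModulus p) a e → e ℕ.∣ k →
                     (+ k) HasValuation κ → q HasValuation σ → b HasValuation (σ ℕ.+ s) → g HasValuation s →
                     OrderCondition a b g q e k ⇔ p^ suc (σ ℕ.+ κ) ∣ a ^ k - 1ℤ
  orderCondition-∣ {a} {e} {q = q} {g = g} order e∣k k-val q-val b-val g-val with a ^ e - 1ℤ ℤ.≟ 0ℤ
  ... | yes aᵉ-1≡0 = let condition , divisibility = orderCondition-aᵉ≡1 {g = g} {q = q} aᵉ-1≡0 e∣k b-val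
                     in mk⇔ (λ _ → divisibility) (λ _ → condition)
  ... | no  aᵉ-1≢0 =
    orderCondition-LTE order (proj₂ (∃-hasValuation aᵉ-1≢0)) e∣k k-val q-val b-val g-val

  p^∣-shift : p^ j ∣ x - A → p^ j ∣ x - 1ℤ ⇔ p^ j ∣ A - 1ℤ
  p^∣-shift {j} {x} {A} p^j∣x-A = mk⇔
    (λ h → p^∣-cancelʳ (subst (p^ j ∣_) (split x A) h) p^j∣x-A)
    (λ h → subst (p^ j ∣_) (sym (split x A)) (p^∣-+ h p^j∣x-A))
    where
    split : ∀ x A → x - 1ℤ ≡ (A - 1ℤ) + (x - A)
    split = solve-∀

  GtSub-nearScalar⇔ : NearScalar (σ ℕ.+ s ℕ.+ κ) A (ak , bk) → g HasValuation s → 1 ≤ s →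
                      GtSub (vp p (ak - 1ℤ)) (vp p bk) (vpNZ p g) ⇔ p^ suc (σ ℕ.+ κ) ∣ A - 1ℤ
  GtSub-nearScalar⇔ {σ} {s} {κ} {A} {ak} {bk} {g} near g-val 1≤s =
    subst₂ (λ v c → GtSub (vp p (ak - 1ℤ)) v c ⇔ p^ suc (σ ℕ.+ κ) ∣ A - 1ℤ)
           (sym vp-bk) (sym (hasValuation⇒vpNZ g-val))
           (⇔.trans (GtSub-vp⇔ (ak - 1ℤ) (σ ℕ.+ κ) s)
                    (p^∣-shift {x = ak} {A = A} (p^∣-mono 1+σ+κ≤σ+s+κ (scalar-congruent near))))
    where
    swap : ∀ σ s κ → σ ℕ.+ s ℕ.+ κ ≡ σ ℕ.+ κ ℕ.+ s
    swap = ℕ-solve-∀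
    vp-bk : vp p bk ≡ just (σ ℕ.+ κ ℕ.+ s)
    vp-bk = trans (hasValuation⇒vp (δ-valuation near)) (cong just (swap σ s κ))
    1+σ+κ≤σ+s+κ : suc (σ ℕ.+ κ) ≤ σ ℕ.+ s ℕ.+ κ
    1+σ+κ≤σ+s+κ = ℕ.+-monoˡ-≤ κ (subst (_≤ σ ℕ.+ s) (ℕ.+-comm σ 1) (ℕ.+-monoʳ-≤ σ 1≤s))

  criterion : a HasValuation 0 → q HasValuation σ → g HasValuation s → 1 ≤ s → b ≡ q * g →
              (+ k) HasValuation κ → powδ (quad t n) (a , b) k ≡ (ak , bk) →
              IsMultOrder (orderModulus p) a e → (p ≡ 2 → vp 2 b ≡ just 1 → k % 2 ≡ 1) →
              GtSub (vp p (ak - 1ℤ)) (vp p bk) (vpNZ p g) ⇔ OrderCondition a b g q e k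
  criterion {a} {q} {σ} {g} {s} {b} {k} {κ} {t} {n} {ak} {bk} {e}
            a-unit q-val g-val 1≤s b≡qg k-val a+bδ^k order v₂b≡1⇒k-odd =
    ⇔.trans (GtSub-nearScalar⇔ {σ = σ} {s = s} {κ = κ} {g = g} near g-val 1≤s) (⇔.sym orderCondition⇔)
    where
    b-val : b HasValuation (σ ℕ.+ s)
    b-val = subst (_HasValuation (σ ℕ.+ s)) (sym b≡qg) (hasValuation-* {q} {σ} {g} {s} q-val g-val)
    exceptional : p ≡ 2 → σ ℕ.+ s ≡ 1 → κ ≡ 0
    exceptional p≡2 β≡1 = p≡2∧odd⇒κ≡0 p≡2 k-odd k-val
      where
      k-odd : ¬ 2 ℕ.∣ k
      k-odd 2∣k = contradiction (trans (sym (ℕ.n∣m⇒m%n≡0 k 2 2∣k))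
        (v₂b≡1⇒k-odd p≡2 (trans (hasValuation⇒vp₂ p≡2 b-val) (cong just β≡1)))) (λ ())
    near : NearScalar (σ ℕ.+ s ℕ.+ κ) (a ^ k) (ak , bk)
    near = subst (NearScalar (σ ℕ.+ s ℕ.+ κ) (a ^ k)) a+bδ^k
      (nearScalar-power (ℕ.≤-trans 1≤s (ℕ.m≤n+m s σ)) b-val a-unit k-val exceptional)
    orderCondition⇔ : OrderCondition a b g q e k ⇔ p^ suc (σ ℕ.+ κ) ∣ a ^ k - 1ℤ
    orderCondition⇔ with e ℕ.∣? k
    ... | yes e∣k = orderCondition-∣ {b = b} {g = g} order e∣k k-val q-val b-val g-val
    ... | no  e∤k = orderCondition-∤ {b = b} {g = g} order e∤k a-unit k-val q-val

  criterion-degenerate : b ≡ 0ℤ * g → powδ δ (a , b) k ≡ (ak , bk) →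
                         GtSub (vp p (ak - 1ℤ)) (vp p bk) (vpNZ p g) ⇔ OrderCondition a b g 0ℤ e k
  criterion-degenerate {b} {g} {δ} {a} {k} {ak} {bk} {e} b≡0*g a+bδ^k =
    mk⇔ (⊥-elim ∘ lhs-impossible) (⊥-elim ∘ rhs-impossible)
    where
    b≡0 : b ≡ 0ℤ
    b≡0 = trans b≡0*g (ℤ.*-zeroˡ g)
    bk≡0 : bk ≡ 0ℤ
    bk≡0 = cong proj₂
      (trans (sym a+bδ^k) (trans (cong (λ b → powδ δ (a , b) k) b≡0) (powδ-scalar δ a k)))
    lhs-impossible : ¬ GtSub (vp p (ak - 1ℤ)) (vp p bk) (vpNZ p g)
    lhs-impossible = subst (λ z → ¬ GtSub (vp p (ak - 1ℤ)) (vp p z) (vpNZ p g)) (sym bk≡0) (GtSub-∞ _ _)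
    rhs-impossible : ¬ OrderCondition a b g 0ℤ e k
    rhs-impossible (inj₁ (gt , _))  = GtSub₂-∞ _ _ _
      (subst (λ z → GtSub₂ (vp p (a ^ e - 1ℤ)) (vpNZ p (+ e)) (vp p z) (vpNZ p g)) b≡0 gt)
    rhs-impossible (inj₂ (_ , _ , ()))

theorem2p9 : (δ : QuadInt) → DegreeTwo δ →
    (a b g q : ℤ) (p : ℕ) → Prime p →
    g ≢ ℤ.0ℤ → (+ p) ∣ g → b ≡ q ℤ.* g → ¬ ((+ p) ∣ a) →
    (k : ℕ) → 1 ℕ.≤ k →
    (ak bk : ℤ) → powδ δ (a , b) k ≡ (ak , bk) →
    (e : ℕ) → IsMultOrder (orderModulus p) a e →
    (p ≡ 2 → vp 2 b ≡ just 1 → k % 2 ≡ 1) →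
    GtSub (vp p (ak ℤ.- ℤ.1ℤ)) (vp p bk) (vpNZ p g)
    ⇔ ((GtSub₂ (vp p (a ℤ.^ e ℤ.- ℤ.1ℤ)) (vpNZ p (+ e)) (vp p b) (vpNZ p g) × (+ e) ∣ (+ k))
       ⊎ (p ≡ 2 × vp 2 (+ k) ≡ just 0 × vp 2 q ≡ just 0))
theorem2p9 (quad t n) _ a b g q p p-prime g≢0 p∣g b≡qg p∤a k 1≤k ak bk a+bδ^k e order v₂b≡1⇒k-odd
  with q ℤ.≟ 0ℤ
... | yes refl = criterion-degenerate p-prime {g = g} {e = e} b≡qg a+bδ^k
... | no  q≢0  =
  let σ , q-val = ∃-hasValuation p-prime q≢0
      s , g-val = ∃-hasValuation p-prime g≢0
      κ , k-val = ∃-hasValuation-ℕ p-prime 1≤k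
      1≤s       = hasValuation-≤ p-prime g-val (p∣⇒p^1∣ p-prime p∣g)
  in criterion p-prime (p∤⇒unit p-prime p∤a) q-val g-val 1≤s b≡qg k-val a+bδ^k order v₂b≡1⇒k-odd
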